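{- For every nonnegative integer $i$ there exists a polynomial $\Psi_i$ with integer coefficients such that $\psi_i(2x+1)=\psi_{i+1}(x)\Psi_i(x)$ for all nonnegative integers $x$.
   Context: For a positive integer $z$, $\Theta_2(z)$ denotes the odd part of $z$, i.e. $z=2^{\nu_2(z)}\Theta_2(z)$ with $\Theta_2(z)$ odd. For nonnegative integers $i$ and $x$, $\psi_i(x)=\Theta_2((2^ix)!)$ (with $0!=1$). -}

module Defs where

open import Data.Nat.Base using (ℕ; zero; suc; _*_; _^_; ⌊_/2⌋; parity; _!)
open import Data.Parity.Base using (0ℙ; 1ℙ)
open import Data.Integer.Base using (ℤ) renaming (_+_ to _+ℤ_; _*_ to _*ℤ_; 0ℤ to zeroℤ)
open import Data.List.Base using (List; []; _∷_)

-- Odd part with fuel: repeatedly halve while even (and nonzero).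
-- Fuel z suffices since z can be halved at most z times.
oddPartAux : ℕ → ℕ → ℕ
oddPartAux zero    n       = n
oddPartAux (suc k) zero    = zero
oddPartAux (suc k) (suc m) with parity (suc m)
... | 0ℙ = oddPartAux k ⌊ suc m /2⌋
... | 1ℙ = suc m

Θ₂ : ℕ → ℕ
Θ₂ z = oddPartAux z z

ψ : ℕ → ℕ → ℕ
ψ i x = Θ₂ ((2 ^ i * x) !)

-- A polynomial with integer coefficients, as its coefficient list
-- [a₀, a₁, …, a_d] (lowest degree first), evaluated by Horner's rule.
IntPoly : Set
IntPoly = List ℤ

eval : IntPoly → ℤ → ℤ
eval []       x = zeroℤ
eval (a ∷ as) x = a +ℤ x *ℤ eval as x

-- Since (2^i (2x+1))! = (2^(i+1) x)! · ∏_{m=1}^{2^i} (2^(i+1) x + m) and the odd part is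
-- multiplicative, it suffices that each factor has polynomial odd part. Writing
-- m = 2^a (2j+1), the bound m ≤ 2^i forces a ≤ i, so 2^(i+1) x + m = 2^a (2j+1 + 2^(i+1-a) x)
-- with the second factor odd: its odd part is the linear polynomial 2j+1 + 2^(i+1-a) x.
module Submission where

open import Defs
open import Data.Nat.Base
  using (ℕ; zero; suc; _+_; _*_; _^_; _∸_; _≤_; _<_; z≤n; s≤s; _!; NonZero; ≢-nonZero)
open import Data.Nat.Properties
open import Data.Nat.Induction using (<-rec)
open import Data.Nat.Tactic.RingSolver using (solve-∀)
import Data.Parity.Properties as Parity
open import Data.Integer.Base using (+_; 0ℤ; 1ℤ) renaming (_+_ to _+ℤ_; _*_ to _*ℤ_)
open import Data.Integer.Properties as ℤ using (pos-+; pos-*)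
import Data.Integer.Tactic.RingSolver as ℤ-Solver
open import Data.List.Base using ([]; _∷_; map)
open import Data.Product using (Σ; ∃₂; _,_)
open import Function.Base using (_∘′_)
open import Relation.Binary.PropositionalEquality
  using (_≡_; refl; sym; trans; cong; cong₂; subst; module ≡-Reasoning)

open ≡-Reasoning

oddPartAux-odd : ∀ k j → oddPartAux k (1 + 2 * j) ≡ 1 + 2 * j
oddPartAux-odd zero    j = refl
oddPartAux-odd (suc k) j rewrite Parity.+-homo-+ 1 (2 * j) | Parity.*-homo-* 2 j = refl

oddPartAux-double : ∀ k m .{{_ : NonZero m}} → oddPartAux (suc k) (2 * m) ≡ oddPartAux k m
oddPartAux-double k m@(suc _) rewrite Parity.*-homo-* 2 m | +-identityʳ m =
  cong (oddPartAux k) (sym (n≡⌊n+n/2⌋ m))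

oddPartAux-2^a*odd : ∀ {k} a j → a ≤ k → oddPartAux k (2 ^ a * (1 + 2 * j)) ≡ 1 + 2 * j
oddPartAux-2^a*odd {k} zero j _ rewrite *-identityˡ (1 + 2 * j) = oddPartAux-odd k j
oddPartAux-2^a*odd {suc k} (suc a) j (s≤s a≤k) = begin
  oddPartAux (suc k) (2 * 2 ^ a * m) ≡⟨ cong (oddPartAux (suc k)) (*-assoc 2 (2 ^ a) m) ⟩
  oddPartAux (suc k) (2 * (2 ^ a * m)) ≡⟨ oddPartAux-double k (2 ^ a * m) {{m*n≢0 (2 ^ a) m {{m^n≢0 2 a}}}} ⟩
  oddPartAux k (2 ^ a * m) ≡⟨ oddPartAux-2^a*odd a j a≤k ⟩
  m ∎
  where m = 1 + 2 * j

n<2^n : ∀ n → n < 2 ^ n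
n<2^n zero    = s≤s z≤n
n<2^n (suc n) = +-mono-≤ (m^n>0 2 n) (≤-trans (n<2^n n) (m≤m+n (2 ^ n) 0))

Θ₂-2^a*odd : ∀ a j → Θ₂ (2 ^ a * (1 + 2 * j)) ≡ 1 + 2 * j
Θ₂-2^a*odd a j = oddPartAux-2^a*odd a j (≤-trans (<⇒≤ (n<2^n a)) (m≤m*n (2 ^ a) (1 + 2 * j)))

TwoAdic : ℕ → Set
TwoAdic n = ∃₂ λ a j → n ≡ 2 ^ a * (1 + 2 * j)

data EvenOdd : ℕ → Set where
  even : ∀ q → EvenOdd (2 * q)
  odd  : ∀ q → EvenOdd (1 + 2 * q)

evenOdd : ∀ n → EvenOdd n
evenOdd zero = even 0
evenOdd (suc n) with evenOdd n
... | even q = odd q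
... | odd q  = subst EvenOdd (*-suc 2 q) (even (suc q))

twoAdic : ∀ n .{{_ : NonZero n}} → TwoAdic n
twoAdic = <-rec (λ n → .{{_ : NonZero n}} → TwoAdic n) step
  where
  step : ∀ n → (∀ {m} → m < n → .{{_ : NonZero m}} → TwoAdic m) → .{{_ : NonZero n}} → TwoAdic n
  step n rec with evenOdd n
  ... | odd q  = 0 , q , sym (*-identityˡ (1 + 2 * q))
  ... | even q@(suc _) with rec (m<m+n q (s≤s z≤n))
  ...   | a , j , q≡ = suc a , j , trans (cong (2 *_) q≡) (sym (*-assoc 2 (2 ^ a) _))

Θ₂-* : ∀ m n .{{_ : NonZero m}} .{{_ : NonZero n}} → Θ₂ (m * n) ≡ Θ₂ m * Θ₂ n
Θ₂-* m n with twoAdic m | twoAdic n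
... | a , j , refl | b , k , refl = begin
  Θ₂ (2 ^ a * (1 + 2 * j) * (2 ^ b * (1 + 2 * k)))
    ≡⟨ cong Θ₂ (regroup (2 ^ a) (2 ^ b) j k) ⟩
  Θ₂ (2 ^ a * 2 ^ b * (1 + 2 * l))
    ≡⟨ cong (λ p → Θ₂ (p * (1 + 2 * l))) (sym (^-distribˡ-+-* 2 a b)) ⟩
  Θ₂ (2 ^ (a + b) * (1 + 2 * l))
    ≡⟨ Θ₂-2^a*odd (a + b) l ⟩
  1 + 2 * l
    ≡⟨ odd*odd j k ⟩
  (1 + 2 * j) * (1 + 2 * k)
    ≡⟨ sym (cong₂ _*_ (Θ₂-2^a*odd a j) (Θ₂-2^a*odd b k)) ⟩
  Θ₂ (2 ^ a * (1 + 2 * j)) * Θ₂ (2 ^ b * (1 + 2 * k)) ∎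
  where
  l = j + k + 2 * j * k
  regroup : ∀ p q j k → p * (1 + 2 * j) * (q * (1 + 2 * k)) ≡ p * q * (1 + 2 * (j + k + 2 * j * k))
  regroup = solve-∀
  odd*odd : ∀ j k → 1 + 2 * (j + k + 2 * j * k) ≡ (1 + 2 * j) * (1 + 2 * k)
  odd*odd = solve-∀

infixl 6 _+ₚ_
infixl 7 _*ₚ_

_+ₚ_ : IntPoly → IntPoly → IntPoly
[]      +ₚ q       = q
(a ∷ p) +ₚ []      = a ∷ p
(a ∷ p) +ₚ (b ∷ q) = (a +ℤ b) ∷ (p +ₚ q)

_*ₚ_ : IntPoly → IntPoly → IntPoly
[]      *ₚ q = []
(a ∷ p) *ₚ q = map (a *ℤ_) q +ₚ (0ℤ ∷ p *ₚ q)

eval-+ₚ : ∀ p q x → eval (p +ₚ q) x ≡ eval p x +ℤ eval q x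
eval-+ₚ []      q       x = sym (ℤ.+-identityˡ (eval q x))
eval-+ₚ (a ∷ p) []      x = sym (ℤ.+-identityʳ (eval (a ∷ p) x))
eval-+ₚ (a ∷ p) (b ∷ q) x rewrite eval-+ₚ p q x = interchange a b x (eval p x) (eval q x)
  where
  interchange : ∀ a b x u v → a +ℤ b +ℤ x *ℤ (u +ℤ v) ≡ a +ℤ x *ℤ u +ℤ (b +ℤ x *ℤ v)
  interchange = ℤ-Solver.solve-∀

eval-map-* : ∀ a q x → eval (map (a *ℤ_) q) x ≡ a *ℤ eval q x
eval-map-* a []      x = sym (ℤ.*-zeroʳ a)
eval-map-* a (b ∷ q) x rewrite eval-map-* a q x = distrib a b x (eval q x)
  where
  distrib : ∀ a b x u → a *ℤ b +ℤ x *ℤ (a *ℤ u) ≡ a *ℤ (b +ℤ x *ℤ u)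
  distrib = ℤ-Solver.solve-∀

eval-*ₚ : ∀ p q x → eval (p *ₚ q) x ≡ eval p x *ℤ eval q x
eval-*ₚ []      q x = sym (ℤ.*-zeroˡ (eval q x))
eval-*ₚ (a ∷ p) q x
  rewrite eval-+ₚ (map (a *ℤ_) q) (0ℤ ∷ p *ₚ q) x | eval-map-* a q x | eval-*ₚ p q x =
  distrib a x (eval p x) (eval q x)
  where
  distrib : ∀ a x u v → a *ℤ v +ℤ (0ℤ +ℤ x *ℤ (u *ℤ v)) ≡ (a +ℤ x *ℤ u) *ℤ v
  distrib = ℤ-Solver.solve-∀

^-cancelˡ-≤ : ∀ m {a b} → 1 < m → m ^ a ≤ m ^ b → a ≤ b
^-cancelˡ-≤ m 1<m mᵃ≤mᵇ = ≮⇒≥ (λ b<a → <⇒≱ (^-monoʳ-< m 1<m b<a) mᵃ≤mᵇ)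

linearOddPart : ℕ → ∀ {m} → TwoAdic m → IntPoly
linearOddPart i (a , j , _) = + (1 + 2 * j) ∷ + (2 * 2 ^ (i ∸ a)) ∷ []

eval-linear : ∀ a b x → eval (+ a ∷ + b ∷ []) (+ x) ≡ + (a + b * x)
eval-linear a b x = begin
  + a +ℤ + x *ℤ (+ b +ℤ + x *ℤ 0ℤ) ≡⟨ reorder (+ a) (+ b) (+ x) ⟩
  + a +ℤ + b *ℤ + x               ≡⟨ cong (+ a +ℤ_) (sym (pos-* b x)) ⟩
  + a +ℤ + (b * x)                 ≡⟨ sym (pos-+ a (b * x)) ⟩
  + (a + b * x)                    ∎
  where
  reorder : ∀ a b x → a +ℤ x *ℤ (b +ℤ x *ℤ 0ℤ) ≡ a +ℤ b *ℤ x
  reorder = ℤ-Solver.solve-∀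

Θ₂-linearOddPart : ∀ i x {m} → m ≤ 2 ^ i → (m≡ : TwoAdic m) →
                   + Θ₂ (2 ^ suc i * x + m) ≡ eval (linearOddPart i m≡) (+ x)
Θ₂-linearOddPart i x m≤2ⁱ (a , j , refl) = begin
  + Θ₂ (2 ^ suc i * x + 2 ^ a * (1 + 2 * j))
    ≡⟨ cong (λ p → + Θ₂ (2 * p * x + 2 ^ a * (1 + 2 * j))) 2ⁱ≡2ᵃ*2ⁱ⁻ᵃ ⟩
  + Θ₂ (2 * (2 ^ a * d) * x + 2 ^ a * (1 + 2 * j))
    ≡⟨ cong (+_ ∘′ Θ₂) (factor-2ᵃ (2 ^ a) d x j) ⟩
  + Θ₂ (2 ^ a * (1 + 2 * (j + d * x)))
    ≡⟨ cong +_ (Θ₂-2^a*odd a (j + d * x)) ⟩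
  + (1 + 2 * (j + d * x))
    ≡⟨ cong +_ (regroup d x j) ⟩
  + (1 + 2 * j + 2 * d * x)
    ≡⟨ sym (eval-linear (1 + 2 * j) (2 * d) x) ⟩
  eval (linearOddPart i (a , j , refl)) (+ x) ∎
  where
  d = 2 ^ (i ∸ a)
  a≤i : a ≤ i
  a≤i = ^-cancelˡ-≤ 2 (s≤s (s≤s z≤n)) (≤-trans (m≤m*n (2 ^ a) (1 + 2 * j)) m≤2ⁱ)
  2ⁱ≡2ᵃ*2ⁱ⁻ᵃ : 2 ^ i ≡ 2 ^ a * d
  2ⁱ≡2ᵃ*2ⁱ⁻ᵃ = trans (cong (2 ^_) (sym (m+[n∸m]≡n a≤i))) (^-distribˡ-+-* 2 a (i ∸ a))
  factor-2ᵃ : ∀ p d x j → 2 * (p * d) * x + p * (1 + 2 * j) ≡ p * (1 + 2 * (j + d * x))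
  factor-2ᵃ = solve-∀
  regroup : ∀ d x j → 1 + 2 * (j + d * x) ≡ 1 + 2 * j + 2 * d * x
  regroup = solve-∀

-- oddRising i M evaluates to ∏_{m=1}^{M} Θ₂ (2^(i+1) x + m); the paper's Ψ_i is oddRising i (2 ^ i).
oddRising : ℕ → ℕ → IntPoly
oddRising i zero    = 1ℤ ∷ []
oddRising i (suc M) = oddRising i M *ₚ linearOddPart i (twoAdic (suc M))

!-+-suc : ∀ n m → (n + suc m) ! ≡ (n + suc m) * (n + m) !
!-+-suc n m rewrite +-suc n m = refl

Θ₂-+! : ∀ i x M → M ≤ 2 ^ i →
        + Θ₂ ((2 ^ suc i * x + M) !) ≡ + Θ₂ ((2 ^ suc i * x) !) *ℤ eval (oddRising i M) (+ x)
Θ₂-+! i x zero _ rewrite +-identityʳ (2 ^ suc i * x) = unit (+ Θ₂ ((2 ^ suc i * x) !)) (+ x)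
  where
  unit : ∀ u x → u ≡ u *ℤ (1ℤ +ℤ x *ℤ 0ℤ)
  unit = ℤ-Solver.solve-∀
Θ₂-+! i x (suc M) sucM≤2ⁱ = begin
  + Θ₂ ((N + suc M) !)
    ≡⟨ cong (+_ ∘′ Θ₂) (!-+-suc N M) ⟩
  + Θ₂ ((N + suc M) * (N + M) !)
    ≡⟨ cong +_ (Θ₂-* (N + suc M) ((N + M) !) {{≢-nonZero (m+1+n≢0 N)}} {{(N + M) !≢0}}) ⟩
  + (Θ₂ (N + suc M) * Θ₂ ((N + M) !))
    ≡⟨ pos-* (Θ₂ (N + suc M)) (Θ₂ ((N + M) !)) ⟩
  + Θ₂ (N + suc M) *ℤ + Θ₂ ((N + M) !)
    ≡⟨ cong₂ _*ℤ_ (Θ₂-linearOddPart i x sucM≤2ⁱ (twoAdic (suc M)))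
                  (Θ₂-+! i x M (≤-trans (n≤1+n M) sucM≤2ⁱ)) ⟩
  eval F (+ x) *ℤ (+ Θ₂ (N !) *ℤ eval (oddRising i M) (+ x))
    ≡⟨ rotate (eval F (+ x)) (+ Θ₂ (N !)) (eval (oddRising i M) (+ x)) ⟩
  + Θ₂ (N !) *ℤ (eval (oddRising i M) (+ x) *ℤ eval F (+ x))
    ≡⟨ cong (+ Θ₂ (N !) *ℤ_) (sym (eval-*ₚ (oddRising i M) F (+ x))) ⟩
  + Θ₂ (N !) *ℤ eval (oddRising i (suc M)) (+ x) ∎
  where
  N = 2 ^ suc i * x
  F = linearOddPart i (twoAdic (suc M))
  rotate : ∀ f u v → f *ℤ (u *ℤ v) ≡ u *ℤ (v *ℤ f)
  rotate = ℤ-Solver.solve-∀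

lemma1 : (i : ℕ) → Σ IntPoly (λ Ψ → (x : ℕ) → + ψ i (2 * x + 1) ≡ + ψ (suc i) x *ℤ eval Ψ (+ x))
lemma1 i = oddRising i (2 ^ i) , λ x → begin
  + Θ₂ ((2 ^ i * (2 * x + 1)) !)     ≡⟨ cong (λ n → + Θ₂ (n !)) (split (2 ^ i) x) ⟩
  + Θ₂ ((2 ^ suc i * x + 2 ^ i) !)   ≡⟨ Θ₂-+! i x (2 ^ i) ≤-refl ⟩
  + ψ (suc i) x *ℤ eval (oddRising i (2 ^ i)) (+ x) ∎
  where
  split : ∀ p x → p * (2 * x + 1) ≡ 2 * p * x + p
  split = solve-∀
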